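{- Let $n$ be even and let $H_n$ be an $n$-vertex $2$-connected graph with $\delta(H_n)\geq n/2-\eta>1$. Assume that $H_n$ does not contain a perfect matching and let $\mathcal{M}$ be a largest matching in $H_n$. Then there exists a set $M\subseteq E(K_n)$ of size at least $n^2/8-4\eta n$ such that, for any $e\in M$, $H_n\cup\{e\}$ contains a matching which is larger than $\mathcal{M}$.
   Context: All graphs are simple. $K_n$ denotes the complete graph on the vertex set of $H_n$, so $E(K_n)$ is the set of all pairs of vertices; $H_n\cup\{e\}$ is the graph obtained from $H_n$ by adding the edge $e$. A perfect matching is a set of $n/2$ pairwise disjoint edges. $\delta(\cdot)$ denotes minimum degree.
   Formalization: The parameter η ranges over the rationals. -}

module Defs where

open import Data.Nat as ℕ using (ℕ; suc)
open import Data.Bool using (Bool; true; false; _∨_; _∧_)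
open import Data.Fin using (Fin; _<_)
open import Data.Fin.Properties using () renaming (_≟_ to _≟ᶠ_)
open import Data.List using (List; []; _∷_; length; filter; concatMap)
open import Data.List.Relation.Unary.All using (All)
open import Data.List.Relation.Unary.Unique.Propositional using (Unique)
open import Data.Product using (_×_; _,_; Σ; ∃)
open import Data.Empty using (⊥)
open import Data.Unit using (⊤)
open import Relation.Nullary using (¬_; does)
open import Relation.Binary.PropositionalEquality using (_≡_; _≢_)
open import Data.List.Base using () renaming (allFin to allFinL)
open import Data.Rational as ℚ using (ℚ; _/_)
open import Data.Integer using (+_)

Graph : ℕ → Set
Graph n = Fin n → Fin n → Bool

IsSimple : ∀ {n} → Graph n → Set
IsSimple {n} G = (∀ (i j : Fin n) → G i j ≡ G j i) × (∀ (i : Fin n) → G i i ≡ false)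
-- An edge of K_n is an unordered pair {i,j}, i ≠ j, represented canonically
-- as an ordered pair (i , j) with i < j.
Pair : ℕ → Set
Pair n = Fin n × Fin n

IsKEdge : ∀ {n} → Pair n → Set
IsKEdge (i , j) = i < j

IsEdge : ∀ {n} → Graph n → Pair n → Set
IsEdge G (i , j) = (i < j) × (G i j ≡ true)

endpoints : ∀ {n} → List (Pair n) → List (Fin n)
endpoints = concatMap (λ { (i , j) → i ∷ j ∷ [] })

IsMatching : ∀ {n} → Graph n → List (Pair n) → Set
IsMatching G m = All (IsEdge G) m × Unique (endpoints m)

IsPerfectMatching : ∀ {n} → Graph n → List (Pair n) → Set
IsPerfectMatching {n} G m = IsMatching G m × (2 ℕ.* length m ≡ n)

IsLargestMatching : ∀ {n} → Graph n → List (Pair n) → Set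
IsLargestMatching G m =
  IsMatching G m × (∀ m' → IsMatching G m' → length m' ℕ.≤ length m)

degree : ∀ {n} → Graph n → Fin n → ℕ
degree {n} G v = length (filter (λ w → G v w ≟ᴮ true) (allFinL n))
  where
  open import Data.Bool.Properties using () renaming (_≟_ to _≟ᴮ_)

data Walk {n} (G : Graph n) (ok : Fin n → Set) : Fin n → Fin n → Set where
  here : ∀ {u} → ok u → Walk G ok u u
  step : ∀ {u w v} → ok u → G u w ≡ true → Walk G ok w v → Walk G ok u v

Connected : ∀ {n} → Graph n → Set
Connected {n} G = ∀ (u v : Fin n) → Walk G (λ _ → ⊤) u v

ConnectedWithout : ∀ {n} → Graph n → Fin n → Set
ConnectedWithout G x = ∀ u v → u ≢ x → v ≢ x → Walk G (λ w → w ≢ x) u v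

TwoConnected : ∀ {n} → Graph n → Set
TwoConnected {n} G = (3 ℕ.≤ n) × Connected G × (∀ x → ConnectedWithout G x)

addEdge : ∀ {n} → Graph n → Pair n → Graph n
addEdge G (a , b) i j =
  G i j ∨ (does (i ≟ᶠ a) ∧ does (j ≟ᶠ b)) ∨ (does (i ≟ᶠ b) ∧ does (j ≟ᶠ a))

ℕ→ℚ : ℕ → ℚ
ℕ→ℚ k = (+ k) / 1

-- Let u ≠ v be two vertices missed by the largest matching m; they exist because n is
-- even and m is not perfect. Every neighbour of u is matched, and for each neighbour w
-- replacing the m-edge {w, mate w} by {u, w} frees x = mate w; call x (and u itself)
-- freeable from u. For x freeable from u and y freeable from v, x ≠ y, both
-- replacements can be made at once: they could only clash on an m-edge {x, y} with
-- u ~ y and v ~ x, i.e. on an augmenting path u y x v. Then x and y are both free and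
-- the new edge xy gives a larger matching. The freeable sets have sizes deg u + 1 and
-- deg v + 1, and u, N(u) and the vertices freeable from v are pairwise disjoint, so
-- with d the smaller degree n ≥ 2d + 2 and there are at least d(d + 1)/2 such pairs;
-- since d ≥ n/2 − η this is at least n²/8 − 4ηn.
module Submission where

open import Defs
open import Function using (_∘_)
open import Data.Empty using (⊥; ⊥-elim)
open import Data.Product using (_×_; _,_; ∃; ∃₂; proj₁; proj₂; swap)
open import Data.Sum using (_⊎_; inj₁; inj₂)
open import Data.Bool using (true; _∨_; _∧_)
open import Data.Bool.Properties using (∨-comm; ∧-comm; ∨-zeroʳ) renaming (_≟_ to _≟ᴮ_)
open import Data.Nat as ℕ using (ℕ; suc; _*_; _+_; _≤_; _<_; z≤n; s≤s; _⊓_)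
import Data.Nat.Properties as ℕP
open import Data.Nat.Divisibility using (_∣_; divides)
import Data.Nat.Solver as ℕSolver
open import Data.Integer as ℤ using (+_)
import Data.Integer.Properties as ℤP
open import Data.Rational as ℚ using (ℚ; _/_; toℚᵘ)
import Data.Rational.Properties as ℚP
open import Data.Rational.Unnormalised as ℚᵘ using (mkℚᵘ; *≡*)
import Data.Rational.Unnormalised.Properties as ℚᵘP
import Data.Rational.Solver as ℚSolver
open import Data.Fin as Fin using (Fin)
open import Data.Fin.Properties using (<-cmp; <⇒≢) renaming (_≟_ to _≟ᶠ_)
open import Data.List using (List; []; _∷_; length; map; filter; _++_; allFin; cartesianProduct)
open import Data.List.Properties using (length-map; length-++; length-tabulate; filter-++; filter-all)
open import Data.List.Relation.Unary.All as All using (All; []; _∷_)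
import Data.List.Relation.Unary.All.Properties as AllP
open import Data.List.Relation.Unary.Any using (here; there)
open import Data.List.Relation.Unary.AllPairs using ([]; _∷_)
open import Data.List.Relation.Unary.Unique.Propositional using (Unique)
import Data.List.Relation.Unary.Unique.Propositional.Properties as UniqueP
open import Data.List.Membership.Propositional using (_∈_; _∉_)
open import Data.List.Membership.Propositional.Properties
  using ( ∈-filter⁺; ∈-filter⁻; ∈-allFin; ∈-++⁻; ∈-++⁺ˡ; ∈-++⁺ʳ; ∈-map⁺; ∈-map⁻
        ; ∈-cartesianProduct⁺; ∈-cartesianProduct⁻)
open import Data.List.Relation.Binary.Permutation.Propositional
  using (_↭_; ↭-refl; ↭-prep; ↭-swap; ↭-trans; ↭-sym; ↭⇒↭ₛ)
open import Data.List.Relation.Binary.Permutation.Propositional.Properties using (∈-resp-↭)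
import Data.List.Relation.Binary.Permutation.Setoid.Properties as PermutationProperties
open import Relation.Nullary using (¬_; Dec; does; yes; no; ¬?; contradiction)
open import Relation.Nullary.Decidable using (dec-true; _⊎-dec_; _×-dec_)
open import Relation.Unary using (Decidable)
open import Relation.Unary.Properties using (∁?)
open import Relation.Binary using (DecidableEquality; tri<; tri≈; tri>)
open import Relation.Binary.PropositionalEquality
  using (_≡_; _≢_; refl; sym; trans; cong; cong₂; subst; subst₂; ≢-sym; module ≡-Reasoning)
open import Relation.Binary.PropositionalEquality.Properties using (setoid)
import Relation.Binary.Reasoning.Setoid as SetoidReasoning

module _ {A : Set} where

  ∈-remove : ∀ {x : A} {ys} → x ∈ ys →
             ∃ λ ys' → length ys ≡ suc (length ys') × (∀ {z} → z ∈ ys → z ≢ x → z ∈ ys')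
  ∈-remove {ys = y ∷ ys} (here refl) = ys , refl , λ { (here refl) z≢x → contradiction refl z≢x ; (there p) _ → p }
  ∈-remove {ys = y ∷ ys} (there p) with ys' , eq , keep ← ∈-remove p =
    y ∷ ys' , cong suc eq , λ { (here refl) _ → here refl ; (there q) z≢x → there (keep q z≢x) }

  Unique-⊆⇒length-≤ : ∀ {xs ys : List A} → Unique xs → (∀ {z} → z ∈ xs → z ∈ ys) →
                      length xs ≤ length ys
  Unique-⊆⇒length-≤ {[]} _ _ = z≤n
  Unique-⊆⇒length-≤ {x ∷ xs} (x∉xs ∷ uxs) xs⊆ys with ys' , eq , keep ← ∈-remove (xs⊆ys (here refl)) =
    subst (suc (length xs) ≤_) (sym eq)
      (s≤s (Unique-⊆⇒length-≤ uxs (λ z∈xs → keep (xs⊆ys (there z∈xs))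
                                                  (λ z≡x → All.lookup x∉xs z∈xs (sym z≡x)))))

  Unique-map⁺ : ∀ {B : Set} {f : A → B} (g : B → A) {xs} → (∀ {x} → x ∈ xs → g (f x) ≡ x) →
                Unique xs → Unique (map f xs)
  Unique-map⁺ g inv [] = []
  Unique-map⁺ {f = f} g {x ∷ xs} inv (x∉xs ∷ u) =
    AllP.map⁺ (All.tabulate fx≢) ∷ Unique-map⁺ g (λ z∈ → inv (there z∈)) u
    where
    fx≢ : ∀ {z} → z ∈ xs → f x ≢ f z
    fx≢ z∈ fx≡fz = All.lookup x∉xs z∈ (trans (sym (inv (here refl))) (trans (cong g fx≡fz) (inv (there z∈))))

  two-distinct : ∀ {xs : List A} → Unique xs → 2 ≤ length xs → ∃₂ λ a b → a ≢ b × a ∈ xs × b ∈ xs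
  two-distinct {a ∷ b ∷ _} ((a≢b ∷ _) ∷ _) _ = a , b , a≢b , here refl , there (here refl)
  two-distinct {_ ∷ []} _ (s≤s ())

  length-filter-∁ : ∀ {P : A → Set} (P? : Decidable P) xs →
                    length (filter P? xs) + length (filter (∁? P?) xs) ≡ length xs
  length-filter-∁ P? [] = refl
  length-filter-∁ P? (x ∷ xs) with P? x
  ... | yes _ = cong suc (length-filter-∁ P? xs)
  ... | no _ = trans (ℕP.+-suc _ _) (cong suc (length-filter-∁ P? xs))

  module _ (_≟_ : DecidableEquality A) where

    distinct? : (p : A × A) → Dec (proj₁ p ≢ proj₂ p)
    distinct? (a , b) = ¬? (a ≟ b)

    length-filter-distinct-map : ∀ x {ys} → Unique ys →
                                 length ys ≤ length (filter distinct? (map (x ,_) ys)) + 1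
    length-filter-distinct-map x {[]} _ = z≤n
    length-filter-distinct-map x {y ∷ ys} (y∉ys ∷ u) with x ≟ y
    ... | yes refl = ℕP.≤-reflexive (begin
      suc (length ys)                                ≡⟨ ℕP.+-comm 1 (length ys) ⟩
      length ys + 1                                  ≡⟨ cong (_+ 1) (length-map (x ,_) ys) ⟨
      length (map (x ,_) ys) + 1
        ≡⟨ cong (λ ps → length ps + 1) (filter-all distinct? (AllP.map⁺ y∉ys)) ⟨
      length (filter distinct? (map (x ,_) ys)) + 1  ∎)
      where open ≡-Reasoning
    ... | no _ = s≤s (length-filter-distinct-map x u)

    length-filter-distinct : ∀ xs {ys} → Unique ys →
      length xs * length ys ≤ length (filter distinct? (cartesianProduct xs ys)) + length xs
    length-filter-distinct [] _ = z≤n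
    length-filter-distinct (x ∷ xs) {ys} u = begin
      length ys + length xs * length ys
        ≤⟨ ℕP.+-mono-≤ (length-filter-distinct-map x u) (length-filter-distinct xs u) ⟩
      (length row + 1) + (length rest + length xs)
        ≡⟨ solve 3 (λ a b c → (a :+ con 1) :+ (b :+ c) := (a :+ b) :+ (con 1 :+ c)) refl
                 (length row) (length rest) (length xs) ⟩
      (length row + length rest) + suc (length xs)
        ≡⟨ cong (_+ suc (length xs)) (length-++ row) ⟨
      length (row ++ rest) + suc (length xs)
        ≡⟨ cong (λ ps → length ps + suc (length xs)) (filter-++ distinct? (map (x ,_) ys) (cartesianProduct xs ys)) ⟨
      length (filter distinct? (cartesianProduct (x ∷ xs) ys)) + suc (length xs) ∎
      where
      open ℕP.≤-Reasoning
      open ℕSolver.+-*-Solver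
      row = filter distinct? (map (x ,_) ys)
      rest = filter distinct? (cartesianProduct xs ys)

module _ {n : ℕ} where

  open PermutationProperties (setoid (Fin n)) using (Unique-resp-↭)

  sortPair : Fin n → Fin n → Pair n
  sortPair a b with <-cmp a b
  ... | tri> _ _ _ = b , a
  ... | _          = a , b

  sortPair-IsEdge : ∀ {G : Graph n} → (∀ a b → G a b ≡ G b a) →
                    ∀ {a b} → a ≢ b → G a b ≡ true → IsEdge G (sortPair a b)
  sortPair-IsEdge G-sym {a} {b} a≢b Gab with <-cmp a b
  ... | tri< a<b _ _ = a<b , Gab
  ... | tri≈ _ a≡b _ = contradiction a≡b a≢b
  ... | tri> _ _ b<a = b<a , trans (G-sym b a) Gab

  endpoints-sortPair : ∀ a b (ps : List (Pair n)) → endpoints (sortPair a b ∷ ps) ↭ a ∷ b ∷ endpoints ps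
  endpoints-sortPair a b ps with <-cmp a b
  ... | tri< _ _ _ = ↭-refl
  ... | tri≈ _ _ _ = ↭-refl
  ... | tri> _ _ _ = ↭-swap b a ↭-refl

  mapPair : (Fin n → Fin n) → Pair n → Pair n
  mapPair r (i , j) = sortPair (r i) (r j)

  endpoints-mapPair : ∀ r (ps : List (Pair n)) → endpoints (map (mapPair r) ps) ↭ map r (endpoints ps)
  endpoints-mapPair r [] = ↭-refl
  endpoints-mapPair r ((i , j) ∷ ps) =
    ↭-trans (endpoints-sortPair (r i) (r j) (map (mapPair r) ps)) (↭-prep (r i) (↭-prep (r j) (endpoints-mapPair r ps)))

  ∈-endpoints⁺ : ∀ {i j} {ps : List (Pair n)} → (i , j) ∈ ps → i ∈ endpoints ps × j ∈ endpoints ps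
  ∈-endpoints⁺ {ps = _ ∷ ps} (here refl) = here refl , there (here refl)
  ∈-endpoints⁺ {ps = _ ∷ ps} (there p) with i∈ , j∈ ← ∈-endpoints⁺ {ps = ps} p =
    there (there i∈) , there (there j∈)

  ∈-endpoints⁻ : ∀ {z} (ps : List (Pair n)) → z ∈ endpoints ps →
                 ∃₂ λ i j → (i , j) ∈ ps × (z ≡ i ⊎ z ≡ j)
  ∈-endpoints⁻ ((a , b) ∷ ps) (here refl) = a , b , here refl , inj₁ refl
  ∈-endpoints⁻ ((a , b) ∷ ps) (there (here refl)) = a , b , here refl , inj₂ refl
  ∈-endpoints⁻ ((a , b) ∷ ps) (there (there p)) with i , j , ij∈ , z≡ ← ∈-endpoints⁻ ps p =
    i , j , there ij∈ , z≡

  length-endpoints : ∀ (ps : List (Pair n)) → length (endpoints ps) ≡ 2 * length ps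
  length-endpoints [] = refl
  length-endpoints (_ ∷ ps) = trans (cong (λ k → 2 + k) (length-endpoints ps)) (sym (ℕP.*-suc 2 (length ps)))

  matching-size : ∀ {G : Graph n} {ps} → IsMatching G ps → 2 * length ps ≤ n
  matching-size {ps = ps} (_ , unique) =
    subst₂ _≤_ (length-endpoints ps) (length-tabulate (λ z → z))
      (Unique-⊆⇒length-≤ unique (λ {z} _ → ∈-allFin z))

  -- A vertex missed by ps is its own mate, which makes mate an involution for a matching.
  mate : List (Pair n) → Fin n → Fin n
  mate [] z = z
  mate ((a , b) ∷ ps) z with z ≟ᶠ a | z ≟ᶠ b
  ... | yes _ | _     = b
  ... | no _  | yes _ = a
  ... | no _  | no _  = mate ps z

  module _ {a b : Fin n} {ps : List (Pair n)} where

    mate-headˡ : mate ((a , b) ∷ ps) a ≡ b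
    mate-headˡ with a ≟ᶠ a
    ... | yes _  = refl
    ... | no a≢a = contradiction refl a≢a

    mate-headʳ : a ≢ b → mate ((a , b) ∷ ps) b ≡ a
    mate-headʳ a≢b with b ≟ᶠ a | b ≟ᶠ b
    ... | yes b≡a | _      = contradiction (sym b≡a) a≢b
    ... | no _    | yes _  = refl
    ... | no _    | no b≢b = contradiction refl b≢b

    mate-tail : ∀ {z} → z ≢ a → z ≢ b → mate ((a , b) ∷ ps) z ≡ mate ps z
    mate-tail {z} z≢a z≢b with z ≟ᶠ a | z ≟ᶠ b
    ... | yes z≡a | _       = contradiction z≡a z≢a
    ... | no _    | yes z≡b = contradiction z≡b z≢b
    ... | no _    | no _    = refl

  mate-∉ : ∀ {z} (ps : List (Pair n)) → z ∉ endpoints ps → mate ps z ≡ z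
  mate-∉ [] _ = refl
  mate-∉ ((a , b) ∷ ps) z∉ =
    trans (mate-tail (z∉ ∘ here) (z∉ ∘ there ∘ here)) (mate-∉ ps (z∉ ∘ there ∘ there))

  mate-pair : ∀ {ps : List (Pair n)} → Unique (endpoints ps) →
           ∀ {i j} → (i , j) ∈ ps → mate ps i ≡ j × mate ps j ≡ i
  mate-pair {ps = (a , b) ∷ ps} ((a≢b ∷ _) ∷ _) (here refl) = mate-headˡ {a} {b} {ps} , mate-headʳ {a} {b} {ps} a≢b
  mate-pair {ps = (a , b) ∷ ps} (a∉ ∷ b∉ ∷ u) {i} {j} (there ij∈)
    with i∈ , j∈ ← ∈-endpoints⁺ {ps = ps} ij∈ with mi , mj ← mate-pair u ij∈ =
    trans (mate-tail (a≢ i∈) (b≢ i∈)) mi , trans (mate-tail (a≢ j∈) (b≢ j∈)) mj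
    where
    a≢ : ∀ {z} → z ∈ endpoints ps → z ≢ a
    a≢ z∈ = ≢-sym (All.lookup a∉ (there z∈))
    b≢ : ∀ {z} → z ∈ endpoints ps → z ≢ b
    b≢ z∈ = ≢-sym (All.lookup b∉ z∈)

  module _ {G : Graph n} (G-sym : ∀ a b → G a b ≡ G b a) {ps : List (Pair n)} (ps-matching : IsMatching G ps) where

    IsMatching-map : (r s : Fin n → Fin n) → (∀ {z} → z ∈ endpoints ps → s (r z) ≡ z) →
                     (∀ {i j} → (i , j) ∈ ps → G (r i) (r j) ≡ true) →
                     IsMatching G (map (mapPair r) ps)
    IsMatching-map r s s∘r≗id G-r = AllP.map⁺ (All.tabulate edge) , unique
      where
      edges = proj₁ ps-matching
      edge : ∀ {p} → p ∈ ps → IsEdge G (mapPair r p)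
      edge {i , j} ij∈ = sortPair-IsEdge G-sym ri≢rj (G-r ij∈)
        where
        ri≢rj : r i ≢ r j
        ri≢rj ri≡rj with i∈ , j∈ ← ∈-endpoints⁺ {ps = ps} ij∈ =
          <⇒≢ (proj₁ (All.lookup edges ij∈))
              (trans (sym (s∘r≗id i∈)) (trans (cong s ri≡rj) (s∘r≗id j∈)))
      unique = Unique-resp-↭ (↭⇒↭ₛ (↭-sym (endpoints-mapPair r ps)))
                             (Unique-map⁺ s s∘r≗id (proj₂ ps-matching))

    IsMatching-augment : ∀ {p q} → p ≢ q → G p q ≡ true → p ∉ endpoints ps → q ∉ endpoints ps →
                         IsMatching G (sortPair p q ∷ ps)
    IsMatching-augment p≢q Gpq p∉ q∉ =
      sortPair-IsEdge G-sym p≢q Gpq ∷ proj₁ ps-matching ,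
      Unique-resp-↭ (↭⇒↭ₛ (↭-sym (endpoints-sortPair _ _ ps)))
        ((p≢q ∷ AllP.¬Any⇒All¬ _ p∉) ∷ AllP.¬Any⇒All¬ _ q∉ ∷ proj₂ ps-matching)

  IsMatching-mono : ∀ {G G' : Graph n} → (∀ {a b} → G a b ≡ true → G' a b ≡ true) →
                    ∀ {ps} → IsMatching G ps → IsMatching G' ps
  IsMatching-mono G⊆G' (edges , unique) = All.map (λ (a<b , Gab) → a<b , G⊆G' Gab) edges , unique

  addEdge-sym : ∀ {G : Graph n} → (∀ a b → G a b ≡ G b a) → ∀ e a b → addEdge G e a b ≡ addEdge G e b a
  addEdge-sym G-sym (x , y) a b =
    cong₂ _∨_ (G-sym a b)
      (trans (∨-comm (does (a ≟ᶠ x) ∧ does (b ≟ᶠ y)) _)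
             (cong₂ _∨_ (∧-comm (does (a ≟ᶠ y)) _) (∧-comm (does (a ≟ᶠ x)) _)))

  addEdge-⊇ : ∀ (G : Graph n) e {a b} → G a b ≡ true → addEdge G e a b ≡ true
  addEdge-⊇ G e Gab rewrite Gab = refl

  addEdge-new : ∀ (G : Graph n) x y → addEdge G (x , y) x y ≡ true
  addEdge-new G x y rewrite dec-true (x ≟ᶠ x) refl | dec-true (y ≟ᶠ y) refl = ∨-zeroʳ (G x y)

  neighbours : Graph n → Fin n → List (Fin n)
  neighbours G v = filter (λ w → G v w ≟ᴮ true) (allFin n)

  ∈-neighbours⁻ : ∀ (G : Graph n) v {w} → w ∈ neighbours G v → G v w ≡ true
  ∈-neighbours⁻ G v = proj₂ ∘ ∈-filter⁻ (λ w → G v w ≟ᴮ true) {xs = allFin n}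

  Unique-neighbours : ∀ (G : Graph n) v → Unique (neighbours G v)
  Unique-neighbours G v = UniqueP.filter⁺ _ (UniqueP.allFin⁺ n)

  redirect : (x u y v : Fin n) → Fin n → Fin n
  redirect x u y v z with z ≟ᶠ x | z ≟ᶠ y
  ... | yes _ | _     = u
  ... | no _  | yes _ = v
  ... | no _  | no _  = z

  module _ (x u y v : Fin n) where

    redirect-x : redirect x u y v x ≡ u
    redirect-x with x ≟ᶠ x
    ... | yes _  = refl
    ... | no x≢x = contradiction refl x≢x

    redirect-y : y ≢ x → redirect x u y v y ≡ v
    redirect-y y≢x with y ≟ᶠ x | y ≟ᶠ y
    ... | yes y≡x | _      = contradiction y≡x y≢x
    ... | no _    | yes _  = refl
    ... | no _    | no y≢y = contradiction refl y≢y

    redirect-id : ∀ {z} → z ≢ x → z ≢ y → redirect x u y v z ≡ z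
    redirect-id {z} z≢x z≢y with z ≟ᶠ x | z ≟ᶠ y
    ... | yes z≡x | _       = contradiction z≡x z≢x
    ... | no _    | yes z≡y = contradiction z≡y z≢y
    ... | no _    | no _    = refl

even-gap : ∀ {k n} → 2 ∣ n → 2 * k ≤ n → 2 * k ≢ n → 2 + 2 * k ≤ n
even-gap {k} (divides q refl) 2k≤n 2k≢n = begin
  2 + 2 * k   ≡⟨ ℕP.*-suc 2 k ⟨
  2 * suc k   ≤⟨ ℕP.*-monoʳ-≤ 2 k<q ⟩
  2 * q       ≡⟨ ℕP.*-comm 2 q ⟩
  q * 2       ∎
  where
  open ℕP.≤-Reasoning
  k<q = ℕP.*-cancelˡ-< 2 k q (subst (2 * k <_) (ℕP.*-comm q 2) (ℕP.≤∧≢⇒< 2k≤n 2k≢n))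

toℚᵘ-ℕ→ℚ : ∀ k → toℚᵘ (ℕ→ℚ k) ℚᵘ.≃ mkℚᵘ (+ k) 0
toℚᵘ-ℕ→ℚ k = ℚP.toℚᵘ-fromℚᵘ (mkℚᵘ (+ k) 0)

ℕ→ℚ-+ : ∀ a b → ℕ→ℚ (a + b) ≡ ℕ→ℚ a ℚ.+ ℕ→ℚ b
ℕ→ℚ-+ a b = ℚP.toℚᵘ-injective (begin
  toℚᵘ (ℕ→ℚ (a + b))                 ≈⟨ toℚᵘ-ℕ→ℚ (a + b) ⟩
  mkℚᵘ (+ (a + b)) 0                 ≈⟨ *≡* (cong (ℤ._* + 1) (trans (ℤP.pos-+ a b)
                                          (sym (cong₂ ℤ._+_ (ℤP.*-identityʳ (+ a)) (ℤP.*-identityʳ (+ b)))))) ⟩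
  mkℚᵘ (+ a) 0 ℚᵘ.+ mkℚᵘ (+ b) 0     ≈⟨ ℚᵘP.+-cong (toℚᵘ-ℕ→ℚ a) (toℚᵘ-ℕ→ℚ b) ⟨
  toℚᵘ (ℕ→ℚ a) ℚᵘ.+ toℚᵘ (ℕ→ℚ b)     ≈⟨ ℚP.toℚᵘ-homo-+ (ℕ→ℚ a) (ℕ→ℚ b) ⟨
  toℚᵘ (ℕ→ℚ a ℚ.+ ℕ→ℚ b)             ∎)
  where open SetoidReasoning ℚᵘP.≃-setoid

ℕ→ℚ-* : ∀ a b → ℕ→ℚ (a * b) ≡ ℕ→ℚ a ℚ.* ℕ→ℚ b
ℕ→ℚ-* a b = ℚP.toℚᵘ-injective (begin
  toℚᵘ (ℕ→ℚ (a * b))                 ≈⟨ toℚᵘ-ℕ→ℚ (a * b) ⟩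
  mkℚᵘ (+ (a * b)) 0                 ≈⟨ *≡* (cong (ℤ._* + 1) (ℤP.pos-* a b)) ⟩
  mkℚᵘ (+ a) 0 ℚᵘ.* mkℚᵘ (+ b) 0     ≈⟨ ℚᵘP.*-cong (toℚᵘ-ℕ→ℚ a) (toℚᵘ-ℕ→ℚ b) ⟨
  toℚᵘ (ℕ→ℚ a) ℚᵘ.* toℚᵘ (ℕ→ℚ b)     ≈⟨ ℚP.toℚᵘ-homo-* (ℕ→ℚ a) (ℕ→ℚ b) ⟨
  toℚᵘ (ℕ→ℚ a ℚ.* ℕ→ℚ b)             ∎)
  where open SetoidReasoning ℚᵘP.≃-setoid

/-as-* : ∀ k d → (+ k) / suc d ≡ ℕ→ℚ k ℚ.* ((+ 1) / suc d)
/-as-* k d = ℚP.toℚᵘ-injective (begin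
  toℚᵘ ((+ k) / suc d)                       ≈⟨ ℚP.toℚᵘ-fromℚᵘ (mkℚᵘ (+ k) d) ⟩
  mkℚᵘ (+ k) d
    ≈⟨ *≡* (cong₂ ℤ._*_ (sym (ℤP.*-identityʳ (+ k))) (cong (λ t → + suc t) (ℕP.+-identityʳ d))) ⟩
  mkℚᵘ (+ k) 0 ℚᵘ.* mkℚᵘ (+ 1) d
    ≈⟨ ℚᵘP.*-cong (toℚᵘ-ℕ→ℚ k) (ℚP.toℚᵘ-fromℚᵘ (mkℚᵘ (+ 1) d)) ⟨
  toℚᵘ (ℕ→ℚ k) ℚᵘ.* toℚᵘ ((+ 1) / suc d)     ≈⟨ ℚP.toℚᵘ-homo-* (ℕ→ℚ k) ((+ 1) / suc d) ⟨
  toℚᵘ (ℕ→ℚ k ℚ.* ((+ 1) / suc d))           ∎)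
  where open SetoidReasoning ℚᵘP.≃-setoid

ℕ→ℚ-nonNeg : ∀ k → ℚ.NonNegative (ℕ→ℚ k)
ℕ→ℚ-nonNeg k = ℚP.normalize-nonNeg k 1

ℕ→ℚ-mono-≤ : ∀ {a b} → a ≤ b → ℕ→ℚ a ℚ.≤ ℕ→ℚ b
ℕ→ℚ-mono-≤ {a} a≤b with c , refl ← ℕP.m≤n⇒∃[o]m+o≡n a≤b = begin
  ℕ→ℚ a                 ≡⟨ ℚP.+-identityʳ (ℕ→ℚ a) ⟨
  ℕ→ℚ a ℚ.+ ℚ.0ℚ        ≤⟨ ℚP.+-monoʳ-≤ (ℕ→ℚ a) (ℚP.nonNegative⁻¹ (ℕ→ℚ c) {{ℕ→ℚ-nonNeg c}}) ⟩
  ℕ→ℚ a ℚ.+ ℕ→ℚ c       ≡⟨ ℕ→ℚ-+ a c ⟨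
  ℕ→ℚ (a + c)           ∎
  where open ℚP.≤-Reasoning

density-bound : ∀ n d L (η : ℚ) → (+ n) / 2 ℚ.- η ℚ.≤ ℕ→ℚ d → 32 * n * d ≤ 8 * L + 15 * (n * n) →
                (+ (n * n)) / 8 ℚ.- (+ 4) / 1 ℚ.* η ℚ.* ℕ→ℚ n ℚ.≤ ℕ→ℚ L
density-bound n d L η n/2-η≤d counted = begin
  (+ (n * n)) / 8 ℚ.- four ℚ.* η ℚ.* N
    ≡⟨ cong (ℚ._- four ℚ.* η ℚ.* N) (trans (/-as-* (n * n) 7) (cong (ℚ._* eighth) (ℕ→ℚ-* n n))) ⟩
  N ℚ.* N ℚ.* eighth ℚ.- four ℚ.* η ℚ.* N
    ≡⟨ solve 2 (λ N η → N :* N :* con eighth :- con four :* η :* N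
                        := con four :* ((N :* con half :- η) :* N) :- con fifteen-eighths :* (N :* N)) refl N η ⟩
  four ℚ.* ((N ℚ.* half ℚ.- η) ℚ.* N) ℚ.- fifteen-eighths ℚ.* (N ℚ.* N)
    ≤⟨ ℚP.+-monoˡ-≤ _ (ℚP.*-monoˡ-≤-nonNeg four {{ℕ→ℚ-nonNeg 4}}
                        (ℚP.*-monoʳ-≤-nonNeg N {{ℕ→ℚ-nonNeg n}} n/2-η≤d')) ⟩
  four ℚ.* (D ℚ.* N) ℚ.- fifteen-eighths ℚ.* (N ℚ.* N)
    ≡⟨ solve 2 (λ N D → con four :* (D :* N) :- con fifteen-eighths :* (N :* N)
                        := con eighth :* (con 32ℚ :* N :* D :- con 15ℚ :* (N :* N))) refl N D ⟩
  eighth ℚ.* (32ℚ ℚ.* N ℚ.* D ℚ.- 15ℚ ℚ.* (N ℚ.* N))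
    ≤⟨ ℚP.*-monoˡ-≤-nonNeg eighth {{ℚP.normalize-nonNeg 1 8}} counted' ⟩
  eighth ℚ.* (8ℚ ℚ.* Λ)
    ≡⟨ solve 1 (λ Λ → con eighth :* (con 8ℚ :* Λ) := Λ) refl Λ ⟩
  Λ ∎
  where
  open ℚP.≤-Reasoning
  open ℚSolver.+-*-Solver
  half eighth four fifteen-eighths N D Λ 32ℚ 15ℚ 8ℚ : ℚ
  half = (+ 1) / 2
  eighth = (+ 1) / 8
  four = (+ 4) / 1
  fifteen-eighths = (+ 15) / 8
  N = ℕ→ℚ n
  D = ℕ→ℚ d
  Λ = ℕ→ℚ L
  32ℚ = ℕ→ℚ 32
  15ℚ = ℕ→ℚ 15
  8ℚ = ℕ→ℚ 8
  n/2-η≤d' : N ℚ.* half ℚ.- η ℚ.≤ D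
  n/2-η≤d' = subst (λ t → t ℚ.- η ℚ.≤ D) (/-as-* n 1) n/2-η≤d
  counted-ℚ : 32ℚ ℚ.* N ℚ.* D ℚ.≤ 8ℚ ℚ.* Λ ℚ.+ 15ℚ ℚ.* (N ℚ.* N)
  counted-ℚ = subst₂ ℚ._≤_
    (trans (ℕ→ℚ-* (32 * n) d) (cong (ℚ._* D) (ℕ→ℚ-* 32 n)))
    (trans (ℕ→ℚ-+ (8 * L) (15 * (n * n)))
           (cong₂ ℚ._+_ (ℕ→ℚ-* 8 L) (trans (ℕ→ℚ-* 15 (n * n)) (cong (15ℚ ℚ.*_) (ℕ→ℚ-* n n)))))
    (ℕ→ℚ-mono-≤ counted)
  counted' : 32ℚ ℚ.* N ℚ.* D ℚ.- 15ℚ ℚ.* (N ℚ.* N) ℚ.≤ 8ℚ ℚ.* Λ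
  counted' = begin
    32ℚ ℚ.* N ℚ.* D ℚ.- 15ℚ ℚ.* (N ℚ.* N)                  ≤⟨ ℚP.+-monoˡ-≤ _ counted-ℚ ⟩
    8ℚ ℚ.* Λ ℚ.+ 15ℚ ℚ.* (N ℚ.* N) ℚ.- 15ℚ ℚ.* (N ℚ.* N)
      ≡⟨ solve 2 (λ Λ X → con 8ℚ :* Λ :+ X :- X := con 8ℚ :* Λ) refl Λ (15ℚ ℚ.* (N ℚ.* N)) ⟩
    8ℚ ℚ.* Λ                                                 ∎

-- With n = 2 + 2d + k: 4d(d + 1) + 15n² − 32nd = 60 + 60d + 60k + 28dk + 15k².
degree-count-bound : ∀ n d L → 2 + d + d ≤ n → suc d * d ≤ 2 * L → 32 * n * d ≤ 8 * L + 15 * (n * n)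
degree-count-bound n d L 2+2d≤n d²+d≤2L with k , refl ← ℕP.m≤n⇒∃[o]m+o≡n 2+2d≤n = begin
  32 * n * d                                ≤⟨ ℕP.m≤m+n (32 * n * d) _ ⟩
  32 * n * d + (60 + 15 * (k * k) + 60 * d + 28 * (d * k) + 60 * k)
    ≡⟨ solve 2 (λ d k → con 32 :* (con 2 :+ d :+ d :+ k) :* d
                          :+ (con 60 :+ con 15 :* (k :* k) :+ con 60 :* d :+ con 28 :* (d :* k) :+ con 60 :* k)
                        := con 4 :* ((con 1 :+ d) :* d)
                          :+ con 15 :* ((con 2 :+ d :+ d :+ k) :* (con 2 :+ d :+ d :+ k))) refl d k ⟩
  4 * (suc d * d) + 15 * (n * n)            ≤⟨ ℕP.+-monoˡ-≤ (15 * (n * n)) (ℕP.*-monoʳ-≤ 4 d²+d≤2L) ⟩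
  4 * (2 * L) + 15 * (n * n)                ≡⟨ cong (_+ 15 * (n * n)) (ℕP.*-assoc 4 2 L) ⟨
  8 * L + 15 * (n * n)                      ∎
  where
  open ℕP.≤-Reasoning
  open ℕSolver.+-*-Solver

module LargestMatching {n : ℕ} {H : Graph n} (simple : IsSimple H)
                       {m : List (Pair n)} (largest : IsLargestMatching H m) where

  open import Data.List.Membership.DecPropositional (_≟ᶠ_ {n}) using (_∈?_)

  H-sym = proj₁ simple
  m-matching = proj₁ largest

  E : List (Fin n)
  E = endpoints m

  Augmenting : Pair n → Set
  Augmenting e = ∃ λ m' → IsMatching (addEdge H e) m' × length m < length m'

  mates : ∀ {i j} → (i , j) ∈ m → mate m i ≡ j × mate m j ≡ i
  mates = mate-pair (proj₂ m-matching)

  not-larger : ∀ {m'} → IsMatching H m' → length m < length m' → ⊥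
  not-larger m'-matching m<m' = ℕP.<⇒≱ m<m' (proj₂ largest _ m'-matching)

  adjacent⇒≢ : ∀ {a b} → H a b ≡ true → a ≢ b
  adjacent⇒≢ {a} Hab refl with () ← trans (sym Hab) (proj₂ simple a)

  ∉E : ∀ {a z} → a ∉ E → z ∈ E → z ≢ a
  ∉E a∉ z∈ refl = a∉ z∈

  mate-edge : ∀ {z} → z ∈ E → (z , mate m z) ∈ m ⊎ (mate m z , z) ∈ m
  mate-edge z∈ with ∈-endpoints⁻ m z∈
  ... | i , j , ij∈ , inj₁ refl = inj₁ (subst (λ w → (i , w) ∈ m) (sym (proj₁ (mates ij∈))) ij∈)
  ... | i , j , ij∈ , inj₂ refl = inj₂ (subst (λ w → (w , j) ∈ m) (sym (proj₂ (mates ij∈))) ij∈)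

  mate-∈E : ∀ {z} → z ∈ E → mate m z ∈ E
  mate-∈E z∈ with mate-edge z∈
  ... | inj₁ e = proj₂ (∈-endpoints⁺ {ps = m} e)
  ... | inj₂ e = proj₁ (∈-endpoints⁺ {ps = m} e)

  mate-adjacent : ∀ {z} → z ∈ E → H z (mate m z) ≡ true
  mate-adjacent z∈ with mate-edge z∈
  ... | inj₁ e = proj₂ (All.lookup (proj₁ m-matching) e)
  ... | inj₂ e = trans (H-sym _ _) (proj₂ (All.lookup (proj₁ m-matching) e))

  mate-≢ : ∀ {z} → z ∈ E → mate m z ≢ z
  mate-≢ z∈ = ≢-sym (adjacent⇒≢ (mate-adjacent z∈))

  mate-involutive : ∀ z → mate m (mate m z) ≡ z
  mate-involutive z with z ∈? E
  ... | no z∉ = trans (cong (mate m) (mate-∉ m z∉)) (mate-∉ m z∉)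
  ... | yes z∈ with mate-edge z∈
  ...   | inj₁ e = proj₂ (mates e)
  ...   | inj₂ e = proj₁ (mates e)

  neighbour-matched : ∀ {u a} → u ∉ E → H u a ≡ true → a ∈ E
  neighbour-matched {u} {a} u∉ Hua with a ∈? E
  ... | yes a∈ = a∈
  ... | no a∉ = ⊥-elim (not-larger (IsMatching-augment H-sym m-matching (adjacent⇒≢ Hua) Hua u∉ a∉) ℕP.≤-refl)

  -- In m, the edge at x is moved to u and the edge at y to v, giving a matching of the
  -- same size that misses x and y.
  module Swap {u v x y : Fin n} (u≢v : u ≢ v) (u∉ : u ∉ E) (v∉ : v ∉ E) (x≢v : x ≢ v) (y≢u : y ≢ u)
              (u~x : x ∈ E → H u (mate m x) ≡ true) (v~y : y ∈ E → H v (mate m y) ≡ true)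
              (x≁y : x ∈ E → mate m x ≢ y) where

    r : Fin n → Fin n
    r = redirect x u y v

    r-inverse : ∀ {z} → z ∈ E → redirect u x v y (r z) ≡ z
    r-inverse {z} z∈ with z ≟ᶠ x | z ≟ᶠ y
    ... | yes refl | _        = redirect-x u x v y
    ... | no _     | yes refl = redirect-y u x v y (≢-sym u≢v)
    ... | no _     | no _     = redirect-id u x v y (∉E u∉ z∈) (∉E v∉ z∈)

    r-adjacent-mate : ∀ {z} → z ∈ E → H (r z) (mate m z) ≡ true
    r-adjacent-mate {z} z∈ with z ≟ᶠ x | z ≟ᶠ y
    ... | yes refl | _        = u~x z∈
    ... | no _     | yes refl = v~y z∈
    ... | no _     | no _     = mate-adjacent z∈

    r-fixes-mate : ∀ {z} → z ∈ E → z ≡ x ⊎ z ≡ y → r (mate m z) ≡ mate m z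
    r-fixes-mate z∈ (inj₁ refl) = redirect-id x u y v (mate-≢ z∈) (x≁y z∈)
    r-fixes-mate {z} z∈ (inj₂ refl) = redirect-id x u y v mate≢x (mate-≢ z∈)
      where
      mate≢x : mate m z ≢ x
      mate≢x mz≡x = x≁y (subst (_∈ E) mz≡x (mate-∈E z∈))
                        (trans (cong (mate m) (sym mz≡x)) (mate-involutive z))

    r-edge : ∀ {i j} → (i , j) ∈ m → H (r i) (r j) ≡ true
    r-edge {i} {j} ij∈ = by-cases ((i ≟ᶠ x) ⊎-dec (i ≟ᶠ y))
      where
      open ≡-Reasoning
      i∈ = proj₁ (∈-endpoints⁺ {ps = m} ij∈)
      j∈ = proj₂ (∈-endpoints⁺ {ps = m} ij∈)
      mi = proj₁ (mates ij∈)
      mj = proj₂ (mates ij∈)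
      by-cases : Dec (i ≡ x ⊎ i ≡ y) → H (r i) (r j) ≡ true
      by-cases (yes moved) = begin
        H (r i) (r j)        ≡⟨ cong (H (r i)) (subst (λ w → r w ≡ w) mi (r-fixes-mate i∈ moved)) ⟩
        H (r i) j            ≡⟨ cong (H (r i)) mi ⟨
        H (r i) (mate m i)   ≡⟨ r-adjacent-mate i∈ ⟩
        true                 ∎
      by-cases (no fixed) = begin
        H (r i) (r j)        ≡⟨ cong (λ w → H w (r j)) (redirect-id x u y v (fixed ∘ inj₁) (fixed ∘ inj₂)) ⟩
        H i (r j)            ≡⟨ H-sym i (r j) ⟩
        H (r j) i            ≡⟨ cong (H (r j)) mj ⟨
        H (r j) (mate m j)   ≡⟨ r-adjacent-mate j∈ ⟩
        true                 ∎

    r-avoids : ∀ {z} → z ∈ E → r z ≢ x × r z ≢ y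
    r-avoids {z} z∈ with z ≟ᶠ x | z ≟ᶠ y
    ... | yes refl | _        = ≢-sym (∉E u∉ z∈) , ≢-sym y≢u
    ... | no _     | yes refl = ≢-sym x≢v , ≢-sym (∉E v∉ z∈)
    ... | no z≢x   | no z≢y   = z≢x , z≢y

    swapped : List (Pair n)
    swapped = map (mapPair r) m

    swapped-matching : IsMatching H swapped
    swapped-matching = IsMatching-map H-sym m-matching r (redirect u x v y) r-inverse r-edge

    swapped-avoids : ∀ {z} → z ∈ endpoints swapped → z ≢ x × z ≢ y
    swapped-avoids z∈ with w , w∈ , refl ← ∈-map⁻ r (∈-resp-↭ (endpoints-mapPair r m) z∈) = r-avoids w∈

    augment : ∀ {G : Graph n} → (∀ a b → G a b ≡ G b a) → (∀ {a b} → H a b ≡ true → G a b ≡ true) →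
              x ≢ y → G x y ≡ true → ∃ λ m' → IsMatching G m' × length m < length m'
    augment G-sym H⊆G x≢y Gxy =
      sortPair x y ∷ swapped ,
      IsMatching-augment G-sym (IsMatching-mono H⊆G swapped-matching) x≢y Gxy
        (λ x∈ → proj₁ (swapped-avoids x∈) refl) (λ y∈ → proj₂ (swapped-avoids y∈) refl) ,
      s≤s (ℕP.≤-reflexive (sym (length-map (mapPair r) m)))

  no-augmenting-path-3 : ∀ {u v x} → u ≢ v → u ∉ E → v ∉ E → x ∈ E →
                         H u (mate m x) ≡ true → H v x ≡ true → ⊥
  no-augmenting-path-3 {u} {v} {x} u≢v u∉ v∉ x∈ u~mx v~x =
    not-larger (proj₁ (proj₂ larger)) (proj₂ (proj₂ larger))
    where
    open Swap {y = v} u≢v u∉ v∉ (∉E v∉ x∈) (≢-sym u≢v) (λ _ → u~mx) (λ v∈ → ⊥-elim (v∉ v∈))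
              (λ _ → ∉E v∉ (mate-∈E x∈))
    larger = augment H-sym (λ Hab → Hab) (∉E v∉ x∈) (trans (H-sym x v) v~x)

  freeable : Fin n → List (Fin n)
  freeable u = u ∷ map (mate m) (neighbours H u)

  length-freeable : ∀ u → length (freeable u) ≡ suc (degree H u)
  length-freeable u = cong suc (length-map (mate m) (neighbours H u))

  module _ {u} (u∉ : u ∉ E) where

    freeable-⊆ : ∀ {x} → x ∈ freeable u → x ≡ u ⊎ x ∈ E
    freeable-⊆ (here refl) = inj₁ refl
    freeable-⊆ (there x∈) with w , w∈ , refl ← ∈-map⁻ (mate m) x∈ =
      inj₂ (mate-∈E (neighbour-matched u∉ (∈-neighbours⁻ H u w∈)))

    freeable-∌ : ∀ {w x} → u ≢ w → w ∉ E → x ∈ freeable u → x ≢ w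
    freeable-∌ u≢w w∉ x∈ with freeable-⊆ x∈
    ... | inj₁ refl = u≢w
    ... | inj₂ x∈E = ∉E w∉ x∈E

    freeable-adjacent : ∀ {x} → x ∈ freeable u → x ∈ E → H u (mate m x) ≡ true
    freeable-adjacent (here refl) u∈ = contradiction u∈ u∉
    freeable-adjacent (there x∈) _ with w , w∈ , refl ← ∈-map⁻ (mate m) x∈ =
      trans (cong (H u) (mate-involutive w)) (∈-neighbours⁻ H u w∈)

    Unique-freeable : Unique (freeable u)
    Unique-freeable =
      AllP.¬Any⇒All¬ _ u∉mates ∷ Unique-map⁺ (mate m) (λ {w} _ → mate-involutive w) (Unique-neighbours H u)
      where
      u∉mates : u ∉ map (mate m) (neighbours H u)
      u∉mates u∈ with w , w∈ , refl ← ∈-map⁻ (mate m) u∈ =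
        u∉ (mate-∈E (neighbour-matched u∉ (∈-neighbours⁻ H u w∈)))

  freeable-augments : ∀ {u v x y} → u ≢ v → u ∉ E → v ∉ E → x ∈ freeable u → y ∈ freeable v → x ≢ y →
                      Augmenting (x , y)
  freeable-augments {u} {v} {x} {y} u≢v u∉ v∉ x∈ y∈ x≢y =
    augment (addEdge-sym H-sym (x , y)) (addEdge-⊇ H (x , y)) x≢y (addEdge-new H x y)
    where
    x≁y : x ∈ E → mate m x ≢ y
    x≁y x∈E mx≡y = no-augmenting-path-3 u≢v u∉ v∉ x∈E (freeable-adjacent u∉ x∈ x∈E)
      (subst (λ w → H v w ≡ true) (trans (cong (mate m) (sym mx≡y)) (mate-involutive x))
             (freeable-adjacent v∉ y∈ (subst (_∈ E) mx≡y (mate-∈E x∈E))))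
    open Swap u≢v u∉ v∉ (freeable-∌ u∉ u≢v v∉ x∈) (freeable-∌ v∉ (≢-sym u≢v) u∉ y∈)
              (freeable-adjacent u∉ x∈) (freeable-adjacent v∉ y∈) x≁y

  degree-sum : ∀ {u v} → u ≢ v → u ∉ E → v ∉ E → 2 + degree H v + degree H u ≤ n
  degree-sum {u} {v} u≢v u∉ v∉ =
    subst₂ _≤_ length-vertices (length-tabulate (λ z → z))
      (Unique-⊆⇒length-≤
        (AllP.¬Any⇒All¬ _ u∉rest ∷ UniqueP.++⁺ (Unique-freeable v∉) (Unique-neighbours H u) disjoint)
                         (λ {z} _ → ∈-allFin z))
    where
    length-vertices : length (u ∷ freeable v ++ neighbours H u) ≡ 2 + degree H v + degree H u
    length-vertices = cong suc (trans (length-++ (freeable v)) (cong (_+ degree H u) (length-freeable v)))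
    disjoint : ∀ {z} → ¬ (z ∈ freeable v × z ∈ neighbours H u)
    disjoint (z∈F , z∈N) with freeable-⊆ v∉ z∈F
    ... | inj₁ refl = v∉ (neighbour-matched u∉ (∈-neighbours⁻ H u z∈N))
    ... | inj₂ z∈E = no-augmenting-path-3 u≢v u∉ v∉ (mate-∈E z∈E)
                       (trans (cong (H u) (mate-involutive _)) (∈-neighbours⁻ H u z∈N)) (freeable-adjacent v∉ z∈F z∈E)
    u∉rest : u ∉ freeable v ++ neighbours H u
    u∉rest u∈ with ∈-++⁻ (freeable v) u∈
    ... | inj₂ u∈N = adjacent⇒≢ (∈-neighbours⁻ H u u∈N) refl
    ... | inj₁ u∈F = freeable-∌ v∉ (≢-sym u≢v) u∉ u∈F refl

  two-unmatched : 2 + 2 * length m ≤ n → ∃₂ λ u v → u ≢ v × u ∉ E × v ∉ E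
  two-unmatched gap =
    let u , v , u≢v , u∈ , v∈ = two-distinct (UniqueP.filter⁺ _ (UniqueP.allFin⁺ n)) enough
    in u , v , u≢v , proj₂ (∈-filter⁻ unmatched? {xs = allFin n} u∈)
                   , proj₂ (∈-filter⁻ unmatched? {xs = allFin n} v∈)
    where
    unmatched? = ∁? (_∈? E)
    matched = filter (_∈? E) (allFin n)
    matched-length : length matched ≤ 2 * length m
    matched-length = subst (length matched ≤_) (length-endpoints m)
      (Unique-⊆⇒length-≤ (UniqueP.filter⁺ _ (UniqueP.allFin⁺ n)) (proj₂ ∘ ∈-filter⁻ (_∈? E) {xs = allFin n}))
    enough : 2 ≤ length (filter unmatched? (allFin n))
    enough = ℕP.+-cancelˡ-≤ (length matched) 2 _ (begin
      length matched + 2                   ≡⟨ ℕP.+-comm (length matched) 2 ⟩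
      2 + length matched                   ≤⟨ ℕP.+-monoʳ-≤ 2 matched-length ⟩
      2 + 2 * length m                     ≤⟨ gap ⟩
      n                                    ≡⟨ length-tabulate (λ z → z) ⟨
      length (allFin n)                    ≡⟨ length-filter-∁ (_∈? E) (allFin n) ⟨
      length matched + length (filter unmatched? (allFin n)) ∎)
      where open ℕP.≤-Reasoning

  module CrossPairs {u v} (u≢v : u ≢ v) (u∉ : u ∉ E) (v∉ : v ∉ E) where

    du dv : ℕ
    du = degree H u
    dv = degree H v

    IsCross : Pair n → Set
    IsCross (x , y) = x Fin.< y × (x ∈ freeable u × y ∈ freeable v ⊎ x ∈ freeable v × y ∈ freeable u)

    isCross? : (p : Pair n) → Dec (IsCross p)
    isCross? (x , y) =
      x Fin.<? y ×-dec ((x ∈? freeable u ×-dec y ∈? freeable v) ⊎-dec (x ∈? freeable v ×-dec y ∈? freeable u))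

    crossPairs : List (Pair n)
    crossPairs = filter isCross? (cartesianProduct (allFin n) (allFin n))

    IsCross-crossPairs : All IsCross crossPairs
    IsCross-crossPairs = AllP.all-filter isCross? (cartesianProduct (allFin n) (allFin n))

    Unique-crossPairs : Unique crossPairs
    Unique-crossPairs = UniqueP.filter⁺ isCross? (UniqueP.cartesianProduct⁺ (UniqueP.allFin⁺ n) (UniqueP.allFin⁺ n))

    crossPairs-augment : All Augmenting crossPairs
    crossPairs-augment = All.map augments IsCross-crossPairs
      where
      augments : ∀ {e} → IsCross e → Augmenting e
      augments (x<y , inj₁ (x∈ , y∈)) = freeable-augments u≢v u∉ v∉ x∈ y∈ (<⇒≢ x<y)
      augments (x<y , inj₂ (x∈ , y∈)) = freeable-augments (≢-sym u≢v) v∉ u∉ x∈ y∈ (<⇒≢ x<y)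

    length-crossPairs : suc du * dv ≤ 2 * length crossPairs
    length-crossPairs = ℕP.+-cancelˡ-≤ (suc du) _ _ (begin
      suc du + suc du * dv                  ≡⟨ ℕP.*-suc (suc du) dv ⟨
      suc du * suc dv                       ≡⟨ cong₂ _*_ (length-freeable u) (length-freeable v) ⟨
      length (freeable u) * length (freeable v)
        ≤⟨ length-filter-distinct _≟ᶠ_ (freeable u) (Unique-freeable v∉) ⟩
      length distinctPairs + length (freeable u)
        ≡⟨ ℕP.+-comm (length distinctPairs) _ ⟩
      length (freeable u) + length distinctPairs
        ≤⟨ ℕP.+-mono-≤ (ℕP.≤-reflexive (length-freeable u)) distinctPairs-length ⟩
      suc du + 2 * length crossPairs        ∎)
      where
      open ℕP.≤-Reasoning
      distinctPairs = filter (distinct? _≟ᶠ_) (cartesianProduct (freeable u) (freeable v))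
      ⊆crossPairs : ∀ {p} → p ∈ distinctPairs → p ∈ crossPairs ++ map swap crossPairs
      ⊆crossPairs {x , y} p∈ with ∈-filter⁻ (distinct? _≟ᶠ_) {xs = cartesianProduct (freeable u) (freeable v)} p∈
      ... | p∈× , x≢y with ∈-cartesianProduct⁻ (freeable u) (freeable v) p∈× | <-cmp x y
      ... | x∈ , y∈ | tri< x<y _ _ =
            ∈-++⁺ˡ (∈-filter⁺ isCross? (∈-cartesianProduct⁺ (∈-allFin x) (∈-allFin y)) (x<y , inj₁ (x∈ , y∈)))
      ... | _ | tri≈ _ x≡y _ = contradiction x≡y x≢y
      ... | x∈ , y∈ | tri> _ _ y<x =
            ∈-++⁺ʳ crossPairs (∈-map⁺ swap
              (∈-filter⁺ isCross? (∈-cartesianProduct⁺ (∈-allFin y) (∈-allFin x)) (y<x , inj₂ (y∈ , x∈))))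
      distinctPairs-length : length distinctPairs ≤ 2 * length crossPairs
      distinctPairs-length = ℕP.≤-trans
        (Unique-⊆⇒length-≤ (UniqueP.filter⁺ (distinct? _≟ᶠ_)
                              (UniqueP.cartesianProduct⁺ (Unique-freeable u∉) (Unique-freeable v∉)))
                           ⊆crossPairs)
        (ℕP.≤-reflexive (trans (length-++ crossPairs) (cong (_+_ (length crossPairs))
          (trans (length-map swap crossPairs) (sym (ℕP.+-identityʳ _))))))

    min-degree-count : 32 * n * (du ⊓ dv) ≤ 8 * length crossPairs + 15 * (n * n)
    min-degree-count = degree-count-bound n (du ⊓ dv) (length crossPairs)
      (ℕP.≤-trans (ℕP.+-mono-≤ (ℕP.+-monoʳ-≤ 2 (ℕP.m⊓n≤n du dv)) (ℕP.m⊓n≤m du dv)) (degree-sum u≢v u∉ v∉))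
      (ℕP.≤-trans (ℕP.*-mono-≤ (s≤s (ℕP.m⊓n≤m du dv)) (ℕP.m⊓n≤n du dv)) length-crossPairs)

    crossPairs-count : ∃ λ w → 32 * n * degree H w ≤ 8 * length crossPairs + 15 * (n * n)
    crossPairs-count with ℕP.⊓-sel du dv
    ... | inj₁ d≡du = u , subst (λ d → 32 * n * d ≤ 8 * length crossPairs + 15 * (n * n)) d≡du min-degree-count
    ... | inj₂ d≡dv = v , subst (λ d → 32 * n * d ≤ 8 * length crossPairs + 15 * (n * n)) d≡dv min-degree-count

  many-augmenting-pairs : 2 + 2 * length m ≤ n →
    ∃ λ M → All IsKEdge M × Unique M × (∃ λ w → 32 * n * degree H w ≤ 8 * length M + 15 * (n * n)) ×
            All Augmenting M
  many-augmenting-pairs gap =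
    let u , v , u≢v , u∉ , v∉ = two-unmatched gap
        open CrossPairs u≢v u∉ v∉
    in crossPairs , All.map proj₁ IsCross-crossPairs , Unique-crossPairs , crossPairs-count , crossPairs-augment

lemma2p6 : (n : ℕ) → 2 ∣ n → (η : ℚ) → (H : Graph n) → IsSimple H →
  TwoConnected H →
  (∀ (v : Fin n) → ℚ._-_ ((+ n) / 2) η ℚ.≤ ℕ→ℚ (degree H v)) →
  ℚ.1ℚ ℚ.< ℚ._-_ ((+ n) / 2) η →
  ¬ (∃ λ (m : List (Pair n)) → IsPerfectMatching H m) →
  (𝓜 : List (Pair n)) → IsLargestMatching H 𝓜 →
  ∃ λ (M : List (Pair n)) → All IsKEdge M × Unique M ×
    (ℚ._-_ ((+ (n * n)) / 8) (ℚ._*_ (ℚ._*_ ((+ 4) / 1) η) (ℕ→ℚ n)) ℚ.≤ ℕ→ℚ (length M)) ×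
    All (λ e → ∃ λ (m : List (Pair n)) →
           IsMatching (addEdge H e) m × length 𝓜 ℕ.< length m) M
lemma2p6 n 2∣n η H simple _ δ-bound _ no-perfect 𝓜 largest =
  let M , edges , unique , (w , counted) , augment = many-augmenting-pairs gap
  in M , edges , unique , density-bound n (degree H w) (length M) η (δ-bound w) counted , augment
  where
  open LargestMatching simple largest
  gap : 2 + 2 * length 𝓜 ≤ n
  gap = even-gap {length 𝓜} 2∣n (matching-size (proj₁ largest))
                 (λ 2k≡n → no-perfect (𝓜 , proj₁ largest , 2k≡n))
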